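{- Let $G$ be the point graph of a nondegenerate partial geometry with parameters $(s,t,t)$ (i.e. $\alpha=t$), and suppose $s\ge 2t-1$. If $G$ is $3$-e.c., then $$s^2-(t^3+t)s+2t^4-2t^3-t^2+3t-1\le 0.$$
   Context: A partial geometry $pg(s,t,\alpha)$ is a point-line incidence structure in which any two distinct points lie on at most one common line, every line contains exactly $s+1$ points, every point lies on exactly $t+1$ lines, and for every point $p$ and line $L$ with $p$ not on $L$ there are exactly $\alpha$ lines through $p$ meeting $L$. It is nondegenerate if $s\ge 2$, $t\ge 1$, $\alpha\ge 1$. A partial geometry with $\alpha=t$ is called a net. Its point graph has the points as vertices, two distinct points adjacent iff collinear. A graph with vertex set $V$ is $n$-e.c. if for every pair of disjoint subsets $A,B\subseteq V$ with $|A\cup B|=n$ (either may be empty) there is a vertex $z\notin A\cup B$ adjacent to every vertex of $A$ and to no vertex of $B$. -}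

module Defs where

open import Data.Nat using (ℕ; zero; suc; _+_; _*_; _≥_; _≤_)
open import Data.Bool using (Bool; true; false; _∧_; _∨_; T)
open import Data.Fin using (Fin; zero; suc)
open import Data.Fin.Subset using (Subset; _∈_; _∉_; _∩_; _∪_; ∣_∣; Empty)
open import Data.Vec using (countᵇ; allFin)
open import Data.Product using (Σ; ∃; _×_; _,_)
open import Relation.Nullary using (¬_)
open import Relation.Binary.PropositionalEquality using (_≡_; _≢_)

anyFin : ∀ {n} → (Fin n → Bool) → Bool
anyFin {zero}  f = false
anyFin {suc n} f = f zero ∨ anyFin (λ i → f (suc i))

#Fin : ∀ {n} → (Fin n → Bool) → ℕ
#Fin {n} f = countᵇ f (allFin n)

record IncidenceStructure : Set where
  field
    v   : ℕ
    b   : ℕ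
    inc : Fin v → Fin b → Bool

  meets : Fin b → Fin b → Bool
  meets M L = anyFin (λ q → inc q M ∧ inc q L)

  Adj : Fin v → Fin v → Set
  Adj p q = p ≢ q × ∃ λ L → T (inc p L) × T (inc q L)

record IsPartialGeometry (S : IncidenceStructure) (s t α : ℕ) : Set where
  open IncidenceStructure S
  field
    nonempty   : Fin v
    atMostOne  : ∀ p q → p ≢ q → ∀ L M →
                 T (inc p L) → T (inc q L) → T (inc p M) → T (inc q M) → L ≡ M
    linePoints : ∀ L → #Fin (λ p → inc p L) ≡ suc s
    pointLines : ∀ p → #Fin (λ L → inc p L) ≡ suc t
    alphaAx    : ∀ p L → ¬ T (inc p L) →
                 #Fin (λ M → inc p M ∧ meets M L) ≡ α

Nondegenerate : ℕ → ℕ → ℕ → Set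
Nondegenerate s t α = (s ≥ 2) × (t ≥ 1) × (α ≥ 1)

IsNEC : ∀ {v} → ℕ → (Fin v → Fin v → Set) → Set
IsNEC {v} n Adj =
  ∀ (A B : Subset v) → Empty (A ∩ B) → ∣ A ∪ B ∣ ≡ n →
  ∃ λ z → z ∉ A × z ∉ B ×
          (∀ a → a ∈ A → Adj z a) × (∀ c → c ∈ B → ¬ Adj z c)

-- In a net pg(s,t,t) pick a point x and a point y not collinear with x.  Double counting
-- paths x ~ z ~ y' shows that x has (s+1-t)s non-neighbours, and comparing with the
-- neighbourhood of y shows that exactly (s-t)^2 + t - 1 points other than x, y are collinear
-- with neither x nor y.  By the 3-e.c. property each such point z has a common neighbour w with x and y, and
-- the line wz avoids x and y.  On a line avoiding x and y the t neighbours of x and the t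
-- neighbours of y overlap in the m common neighbours it carries, so it holds at most
-- s+1-2t+m <= (s+2-2t)m of those points; summing m over all lines avoiding x and y gives
-- (t-1)t(t+1).  Hence (s-t)^2 + t - 1 <= (s+2-2t)(t-1)t(t+1), which is the stated inequality.

module Submission where

open import Defs
open import Data.Nat using (ℕ; zero; suc; _+_; _*_; _∸_; _≥_; _≤_; _<_; z≤n; s≤s; NonZero)
open import Data.Nat.Properties
  using ( suc-injective; ≤-refl; ≤-trans; ≤-reflexive; +-mono-≤; +-monoˡ-≤; +-cancelʳ-≤
        ; +-cancelʳ-≡; +-comm; *-comm; +-assoc; +-suc; +-identityʳ; *-identityˡ; *-identityʳ
        ; *-zeroʳ; *-distribʳ-+; *-cancelʳ-≡; *-mono-≤; m≤m*n; m≤n+m; m*n≢0; m∸n+n≡m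
        ; +-*-semiring; +-commutativeSemigroup; module ≤-Reasoning)
open import Data.Nat.Solver using () renaming (module +-*-Solver to ℕ-Solver)
open import Data.Integer using (ℤ; +_; _^_)
import Data.Integer as ℤ
open import Data.Integer.Properties using (pos-+; pos-*; i≤j⇒i-j≤0)
open import Data.Integer.Solver using () renaming (module +-*-Solver to ℤ-Solver)
open import Data.Bool using (Bool; true; false; T; _∧_; if_then_else_)
open import Data.Bool.Properties using (T-∧)
open import Data.Fin using (Fin; zero; suc; _≟_)
open import Data.Fin.Properties using (any?)
import Data.Fin.Properties as Fin
open import Data.Fin.Subset
  using (Subset; inside; outside; _∈_; _∪_; _∩_; ⁅_⁆; ∣_∣; Empty) renaming (⊥ to ∅)
open import Data.Fin.Subset.Properties
  using ( x∈p∩q⁻; x∈p∪q⁻; x∈p∪q⁺; x∈⁅x⁆; x∈⁅y⁆⇒x≡y; Empty-unique; ∣⊥∣≡0; ∣⁅x⁆∣≡1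
        ; ∪-identityʳ; ∉⊥)
open import Data.Vec using ([]; _∷_; countᵇ; tabulate)
open import Data.Product using (∃; _×_; _,_; proj₁; proj₂; swap; map₂; <_,_>)
open import Data.Sum using (_⊎_; inj₁; inj₂; [_,_])
open import Data.Empty using (⊥; ⊥-elim)
open import Data.Unit using (tt)
open import Function using (_∘_; id)
open import Function.Bundles using (_⇔_; mk⇔; Equivalence)
open import Relation.Nullary using (¬_; Dec; does; yes; no; T?; ¬?; _×-dec_; _⊎-dec_)
open import Relation.Unary using (Pred; Decidable; _⊆_; _≐_)
open import Relation.Unary.Properties using (_∩?_; _∪?_; ∁?; U?)
open import Relation.Binary.PropositionalEquality
  using (_≡_; _≢_; refl; sym; trans; cong; cong₂; subst; subst₂; module ≡-Reasoning)
open import Algebra.Properties.Semiring.Sum +-*-semiring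
  using (sum-syntax; sum-cong-≗; ∑-distrib-+; ∑-comm; *-distribˡ-sum)
open import Algebra.Properties.CommutativeSemigroup +-commutativeSemigroup using (xy∙z≈xz∙y)

private variable
  m n : ℕ
  A B : Set
  P Q : Pred (Fin n) _
  R : Fin m → Fin n → Set

𝟙 : Dec A → ℕ
𝟙 a? = if does a? then 1 else 0

count : {P : Pred (Fin n) _} → Decidable P → ℕ
count {n} P? = ∑[ i < n ] 𝟙 (P? i)

𝟙-cong : {a? : Dec A} {b? : Dec B} → (A → B) → (B → A) → 𝟙 a? ≡ 𝟙 b?
𝟙-cong {a? = yes a} {yes b}  _ _ = refl
𝟙-cong {a? = yes a} {no ¬b}  f _ = ⊥-elim (¬b (f a))
𝟙-cong {a? = no ¬a} {yes b}  _ g = ⊥-elim (¬a (g b))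
𝟙-cong {a? = no _}  {no _}   _ _ = refl

𝟙-mono : {a? : Dec A} {b? : Dec B} → (A → B) → 𝟙 a? ≤ 𝟙 b?
𝟙-mono {a? = yes a} {yes b}  _ = ≤-refl
𝟙-mono {a? = yes a} {no ¬b}  f = ⊥-elim (¬b (f a))
𝟙-mono {a? = no _}           _ = z≤n

𝟙-⊎+× : (a? : Dec A) (b? : Dec B) → 𝟙 (a? ⊎-dec b?) + 𝟙 (a? ×-dec b?) ≡ 𝟙 a? + 𝟙 b?
𝟙-⊎+× (yes _) (yes _) = refl
𝟙-⊎+× (yes _) (no _)  = refl
𝟙-⊎+× (no _)  (yes _) = refl
𝟙-⊎+× (no _)  (no _)  = refl

𝟙-split : (a? : Dec A) (b? : Dec B) → 𝟙 a? ≡ 𝟙 (a? ×-dec b?) + 𝟙 (a? ×-dec ¬? b?)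
𝟙-split (yes _) (yes _) = refl
𝟙-split (yes _) (no _)  = refl
𝟙-split (no _)  _       = refl

count-cong : (P? : Decidable P) (Q? : Decidable Q) → P ≐ Q → count P? ≡ count Q?
count-cong P? Q? (P⊆Q , Q⊆P) = sum-cong-≗ λ i → 𝟙-cong {a? = P? i} {b? = Q? i} P⊆Q Q⊆P

count-mono : (P? : Decidable P) (Q? : Decidable Q) → P ⊆ Q → count P? ≤ count Q?
count-mono {zero}  P? Q? P⊆Q = z≤n
count-mono {suc n} P? Q? P⊆Q =
  +-mono-≤ (𝟙-mono {a? = P? zero} {b? = Q? zero} P⊆Q) (count-mono (P? ∘ suc) (Q? ∘ suc) P⊆Q)

count-∪+∩ : (P? : Decidable P) (Q? : Decidable Q) →
            count (P? ∪? Q?) + count (P? ∩? Q?) ≡ count P? + count Q?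
count-∪+∩ P? Q? = begin
  count (P? ∪? Q?) + count (P? ∩? Q?)                      ≡⟨ ∑-distrib-+ (𝟙 ∘ (P? ∪? Q?)) (𝟙 ∘ (P? ∩? Q?)) ⟨
  ∑[ i < _ ] (𝟙 (P? i ⊎-dec Q? i) + 𝟙 (P? i ×-dec Q? i))   ≡⟨ sum-cong-≗ (λ i → 𝟙-⊎+× (P? i) (Q? i)) ⟩
  ∑[ i < _ ] (𝟙 (P? i) + 𝟙 (Q? i))                         ≡⟨ ∑-distrib-+ (𝟙 ∘ P?) (𝟙 ∘ Q?) ⟩
  count P? + count Q?                                      ∎
  where open ≡-Reasoning

count-split : (P? : Decidable P) (Q? : Decidable Q) →
              count P? ≡ count (P? ∩? Q?) + count (P? ∩? ∁? Q?)
count-split P? Q? =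
  trans (sum-cong-≗ (λ i → 𝟙-split (P? i) (Q? i))) (∑-distrib-+ (𝟙 ∘ (P? ∩? Q?)) (𝟙 ∘ (P? ∩? ∁? Q?)))

count-none : (P? : Decidable P) → (∀ i → ¬ P i) → count P? ≡ 0
count-none {zero}  P? ¬P = refl
count-none {suc n} P? ¬P with P? zero
... | yes p = ⊥-elim (¬P zero p)
... | no _  = count-none (P? ∘ suc) (¬P ∘ suc)

count-unique : (P? : Decidable P) {i : Fin n} → P i → (∀ {j} → P j → j ≡ i) → count P? ≡ 1
count-unique {suc n} P? {zero} p₀ unique with P? zero
... | yes _  = cong suc (count-none (P? ∘ suc) (λ j p → Fin.0≢1+n (sym (unique p))))
... | no ¬p₀ = ⊥-elim (¬p₀ p₀)
count-unique {suc n} P? {suc i} pᵢ unique with P? zero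
... | yes p₀ = ⊥-elim (Fin.0≢1+n (unique p₀))
... | no _   = count-unique (P? ∘ suc) pᵢ (Fin.suc-injective ∘ unique)

count>0⇒∃ : (P? : Decidable P) → 0 < count P? → ∃ P
count>0⇒∃ {suc n} P? pos with P? zero
... | yes p₀ = zero , p₀
... | no _   = let i , pᵢ = count>0⇒∃ (P? ∘ suc) pos in suc i , pᵢ

∃⇒count>0 : (P? : Decidable P) {i : Fin n} → P i → 0 < count P?
∃⇒count>0 P? {i} pᵢ = subst (_≤ count P?) (count-unique (_≟ i) refl id)
                        (count-mono (_≟ i) P? λ { refl → pᵢ })

∑-mono-≤ : {f g : Fin n → ℕ} → (∀ i → f i ≤ g i) → ∑[ i < n ] f i ≤ ∑[ i < n ] g i
∑-mono-≤ {zero}  f≤g = z≤n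
∑-mono-≤ {suc n} f≤g = +-mono-≤ (f≤g zero) (∑-mono-≤ (f≤g ∘ suc))

∑-constant-on : (P? : Decidable P) (g : Fin n → ℕ) {c : ℕ} →
                (∀ i → P i → g i ≡ c) → (∀ i → ¬ P i → g i ≡ 0) →
                ∑[ i < n ] g i ≡ c * count P?
∑-constant-on {n} P? g {c} on off = begin
  ∑[ i < n ] g i             ≡⟨ sum-cong-≗ g≗c𝟙 ⟩
  ∑[ i < n ] (c * 𝟙 (P? i))  ≡⟨ *-distribˡ-sum c (𝟙 ∘ P?) ⟨
  c * count P?               ∎
  where
  open ≡-Reasoning
  g≗c𝟙 : ∀ i → g i ≡ c * 𝟙 (P? i)
  g≗c𝟙 i with P? i
  ... | yes p = trans (on i p) (sym (*-identityʳ c))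
  ... | no ¬p = trans (off i ¬p) (sym (*-zeroʳ c))

∑-count-comm : (R? : ∀ i j → Dec (R i j)) →
               ∑[ i < m ] count (R? i) ≡ ∑[ j < n ] count (λ i → R? i j)
∑-count-comm R? = ∑-comm (λ i j → 𝟙 (R? i j))

count≤∑-cover : (P? : Decidable P) (R? : ∀ i j → Dec (R i j)) →
                (∀ {j} → P j → ∃ λ i → R i j) → count P? ≤ ∑[ i < m ] count (R? i)
count≤∑-cover P? R? cover = begin
  count P?                            ≤⟨ ∑-mono-≤ 𝟙≤fibre ⟩
  ∑[ j < _ ] count (λ i → R? i j)    ≡⟨ ∑-count-comm R? ⟨
  ∑[ i < _ ] count (R? i)            ∎
  where
  open ≤-Reasoning
  𝟙≤fibre : ∀ j → 𝟙 (P? j) ≤ count (λ i → R? i j)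
  𝟙≤fibre j with P? j
  ... | yes p = let i , r = cover p in ∃⇒count>0 (λ i → R? i j) r
  ... | no _  = z≤n

countᵇ-tabulate : (f : A → Bool) (g : Fin n → A) → countᵇ f (tabulate g) ≡ count (T? ∘ f ∘ g)
countᵇ-tabulate {n = zero}  f g = refl
countᵇ-tabulate {n = suc n} f g with f (g zero)
... | true  = cong suc (countᵇ-tabulate f (g ∘ suc))
... | false = countᵇ-tabulate f (g ∘ suc)

#Fin≡count : (f : Fin n → Bool) → #Fin f ≡ count (T? ∘ f)
#Fin≡count f = countᵇ-tabulate f id

T-anyFin : {f : Fin n → Bool} → T (anyFin f) ⇔ ∃ (T ∘ f)
T-anyFin = mk⇔ to from
  where
  to : ∀ {n} {f : Fin n → Bool} → T (anyFin f) → ∃ (T ∘ f)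
  to {suc n} {f} h with f zero in eq
  ... | true  = zero , subst T (sym eq) _
  ... | false = let i , fi = to {f = f ∘ suc} h in suc i , fi
  from : ∀ {n} {f : Fin n → Bool} → ∃ (T ∘ f) → T (anyFin f)
  from {f = f} (zero , fi) with f zero
  ... | true = _
  from {f = f} (suc i , fi) with f zero
  ... | true  = _
  ... | false = from {f = f ∘ suc} (i , fi)

count-∧ : (f g : Fin n → Bool) → count (T? ∘ λ i → f i ∧ g i) ≡ count ((T? ∘ f) ∩? (T? ∘ g))
count-∧ f g = count-cong (T? ∘ λ i → f i ∧ g i) ((T? ∘ f) ∩? (T? ∘ g))
  ((λ {i} → Equivalence.to (T-∧ {f i})) , (λ {i} → Equivalence.from (T-∧ {f i})))

count-∩-U : (P? : Decidable P) → count (P? ∩? U?) ≡ count P?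
count-∩-U P? = count-cong (P? ∩? U?) P? (proj₁ , (_, tt))

count-∩-comm : (P? : Decidable P) (Q? : Decidable Q) → count (P? ∩? Q?) ≡ count (Q? ∩? P?)
count-∩-comm P? Q? = count-cong (P? ∩? Q?) (Q? ∩? P?) (swap , swap)

count-disjoint-+≤ : {X : Pred (Fin n) _} (P? : Decidable P) (Q? : Decidable Q) (X? : Decidable X) →
                    (∀ i → P i → Q i → ⊥) → P ⊆ X → Q ⊆ X → count P? + count Q? ≤ count X?
count-disjoint-+≤ P? Q? X? disjoint P⊆X Q⊆X = begin
  count P? + count Q?                     ≡⟨ count-∪+∩ P? Q? ⟨
  count (P? ∪? Q?) + count (P? ∩? Q?)     ≡⟨ cong (_+_ (count (P? ∪? Q?))) P∩Q≡0 ⟩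
  count (P? ∪? Q?) + 0                    ≡⟨ +-identityʳ _ ⟩
  count (P? ∪? Q?)                        ≤⟨ count-mono (P? ∪? Q?) X? [ P⊆X , Q⊆X ] ⟩
  count X?                                ∎
  where
  open ≤-Reasoning
  P∩Q≡0 : count (P? ∩? Q?) ≡ 0
  P∩Q≡0 = count-none (P? ∩? Q?) (λ i (p , q) → disjoint i p q)

∣p∪q∣+∣p∩q∣≡∣p∣+∣q∣ : ∀ {n} (p q : Subset n) → ∣ p ∪ q ∣ + ∣ p ∩ q ∣ ≡ ∣ p ∣ + ∣ q ∣
∣p∪q∣+∣p∩q∣≡∣p∣+∣q∣ []            []            = refl
∣p∪q∣+∣p∩q∣≡∣p∣+∣q∣ (outside ∷ p) (outside ∷ q) = ∣p∪q∣+∣p∩q∣≡∣p∣+∣q∣ p q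
∣p∪q∣+∣p∩q∣≡∣p∣+∣q∣ (inside  ∷ p) (outside ∷ q) = cong suc (∣p∪q∣+∣p∩q∣≡∣p∣+∣q∣ p q)
∣p∪q∣+∣p∩q∣≡∣p∣+∣q∣ (outside ∷ p) (inside  ∷ q) =
  trans (cong suc (∣p∪q∣+∣p∩q∣≡∣p∣+∣q∣ p q)) (sym (+-suc ∣ p ∣ ∣ q ∣))
∣p∪q∣+∣p∩q∣≡∣p∣+∣q∣ (inside  ∷ p) (inside  ∷ q) = cong suc
  (trans (+-suc ∣ p ∪ q ∣ ∣ p ∩ q ∣) (trans (cong suc (∣p∪q∣+∣p∩q∣≡∣p∣+∣q∣ p q)) (sym (+-suc ∣ p ∣ ∣ q ∣))))

∣p∪q∣≡∣p∣+∣q∣ : ∀ {n} (p q : Subset n) → Empty (p ∩ q) → ∣ p ∪ q ∣ ≡ ∣ p ∣ + ∣ q ∣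
∣p∪q∣≡∣p∣+∣q∣ {n} p q disjoint = begin
  ∣ p ∪ q ∣                  ≡⟨ +-identityʳ _ ⟨
  ∣ p ∪ q ∣ + 0              ≡⟨ cong (_+_ (∣ p ∪ q ∣)) ∣p∩q∣≡0 ⟨
  ∣ p ∪ q ∣ + ∣ p ∩ q ∣      ≡⟨ ∣p∪q∣+∣p∩q∣≡∣p∣+∣q∣ p q ⟩
  ∣ p ∣ + ∣ q ∣              ∎
  where
  open ≡-Reasoning
  ∣p∩q∣≡0 : ∣ p ∩ q ∣ ≡ 0
  ∣p∩q∣≡0 = trans (cong ∣_∣ (Empty-unique disjoint)) (∣⊥∣≡0 n)

IsNEC-3⇒common-neighbour : ∀ {v} {E : Fin v → Fin v → Set} → IsNEC 3 E →
  ∀ {x y z} → x ≢ y → x ≢ z → y ≢ z → ∃ λ w → E w x × E w y × E w z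
IsNEC-3⇒common-neighbour {v} nec {x} {y} {z} x≢y x≢z y≢z =
  let w , _ , _ , adjacent , _ = nec xyz ∅ (λ (_ , i∈) → ∉⊥ (proj₂ (x∈p∩q⁻ xyz ∅ i∈))) ∣xyz∪∅∣≡3
  in w , adjacent x (x∈p∪q⁺ (inj₁ (x∈⁅x⁆ x)))
       , adjacent y (x∈p∪q⁺ (inj₂ (x∈p∪q⁺ (inj₁ (x∈⁅x⁆ y)))))
       , adjacent z (x∈p∪q⁺ (inj₂ (x∈p∪q⁺ (inj₂ (x∈⁅x⁆ z)))))
  where
  xyz : Subset v
  xyz = ⁅ x ⁆ ∪ ⁅ y ⁆ ∪ ⁅ z ⁆
  ⁅⁆-meet : ∀ {i p q} → i ∈ ⁅ p ⁆ → i ∈ ⁅ q ⁆ → p ≡ q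
  ⁅⁆-meet {q = q} i∈p i∈q = trans (sym (x∈⁅y⁆⇒x≡y _ i∈p)) (x∈⁅y⁆⇒x≡y q i∈q)
  y∉z : Empty (⁅ y ⁆ ∩ ⁅ z ⁆)
  y∉z (_ , i∈) = let i∈y , i∈z = x∈p∩q⁻ ⁅ y ⁆ ⁅ z ⁆ i∈ in y≢z (⁅⁆-meet i∈y i∈z)
  x∉yz : Empty (⁅ x ⁆ ∩ (⁅ y ⁆ ∪ ⁅ z ⁆))
  x∉yz (_ , i∈) with x∈p∩q⁻ ⁅ x ⁆ (⁅ y ⁆ ∪ ⁅ z ⁆) i∈
  ... | i∈x , i∈yz with x∈p∪q⁻ ⁅ y ⁆ ⁅ z ⁆ i∈yz
  ... | inj₁ i∈y = x≢y (⁅⁆-meet i∈x i∈y)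
  ... | inj₂ i∈z = x≢z (⁅⁆-meet i∈x i∈z)
  ∣xyz∪∅∣≡3 : ∣ xyz ∪ ∅ ∣ ≡ 3
  ∣xyz∪∅∣≡3 = begin
    ∣ xyz ∪ ∅ ∣                         ≡⟨ cong ∣_∣ (∪-identityʳ xyz) ⟩
    ∣ ⁅ x ⁆ ∪ ⁅ y ⁆ ∪ ⁅ z ⁆ ∣         ≡⟨ ∣p∪q∣≡∣p∣+∣q∣ ⁅ x ⁆ (⁅ y ⁆ ∪ ⁅ z ⁆) x∉yz ⟩
    ∣ ⁅ x ⁆ ∣ + ∣ ⁅ y ⁆ ∪ ⁅ z ⁆ ∣     ≡⟨ cong (_+_ (∣ ⁅ x ⁆ ∣)) (∣p∪q∣≡∣p∣+∣q∣ ⁅ y ⁆ ⁅ z ⁆ y∉z) ⟩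
    ∣ ⁅ x ⁆ ∣ + (∣ ⁅ y ⁆ ∣ + ∣ ⁅ z ⁆ ∣) ≡⟨ cong₂ _+_ (∣⁅x⁆∣≡1 x) (cong₂ _+_ (∣⁅x⁆∣≡1 y) (∣⁅x⁆∣≡1 z)) ⟩
    3                                 ∎
    where open ≡-Reasoning

m+n≤[m+1]*n : ∀ m n → 0 < n → m + n ≤ (m + 1) * n
m+n≤[m+1]*n m n@(suc _) _ = begin
  m + n          ≤⟨ +-monoˡ-≤ n (m≤m*n m n) ⟩
  m * n + n      ≡⟨ cong (_+_ (m * n)) (*-identityˡ n) ⟨
  m * n + 1 * n  ≡⟨ *-distribʳ-+ n m 1 ⟨
  (m + 1) * n    ∎
  where open ≤-Reasoning

netPolynomial : ℤ → ℤ → ℤ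
netPolynomial s t =
  s ^ 2 ℤ.- (t ^ 3 ℤ.+ t) ℤ.* s ℤ.+ (+ 2) ℤ.* t ^ 4
    ℤ.- (+ 2) ℤ.* t ^ 3 ℤ.- t ^ 2 ℤ.+ (+ 3) ℤ.* t ℤ.- (+ 1)

-- With s = 1 + d + 2w and t = 1 + w the polynomial is (s - t)² + t - 1 minus (s + 2 - 2t)(t - 1)t(t + 1).
netPolynomial-factor : ∀ d w → netPolynomial (+ 1 ℤ.+ (d ℤ.+ w ℤ.+ w)) (+ 1 ℤ.+ w) ≡
  ((d ℤ.+ w) ℤ.* (d ℤ.+ w) ℤ.+ w) ℤ.- (d ℤ.+ + 1) ℤ.* (w ℤ.* ((+ 1 ℤ.+ w) ℤ.* (+ 2 ℤ.+ w)))
netPolynomial-factor = solve 2 (λ d w →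
    let s = con (+ 1) :+ (d :+ w :+ w) ; t = con (+ 1) :+ w in
    s :^ 2 :- (t :^ 3 :+ t) :* s :+ con (+ 2) :* t :^ 4
      :- con (+ 2) :* t :^ 3 :- t :^ 2 :+ con (+ 3) :* t :- con (+ 1)
    := ((d :+ w) :* (d :+ w) :+ w) :- (d :+ con (+ 1)) :* (w :* ((con (+ 1) :+ w) :* (con (+ 2) :+ w))))
  refl
  where open ℤ-Solver

netPolynomial≡ : ∀ d w → netPolynomial (+ suc (d + w + w)) (+ suc w) ≡
  + ((d + w) * (d + w) + w) ℤ.- + ((d + 1) * (w * (suc w * suc (suc w))))
netPolynomial≡ d w = begin
  netPolynomial (+ suc (d + w + w)) (+ suc w)
    ≡⟨ cong₂ netPolynomial s≡ (pos-+ 1 w) ⟩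
  netPolynomial (+ 1 ℤ.+ (+ d ℤ.+ + w ℤ.+ + w)) (+ 1 ℤ.+ + w)
    ≡⟨ netPolynomial-factor (+ d) (+ w) ⟩
  ((+ d ℤ.+ + w) ℤ.* (+ d ℤ.+ + w) ℤ.+ + w) ℤ.- (+ d ℤ.+ + 1) ℤ.* (+ w ℤ.* ((+ 1 ℤ.+ + w) ℤ.* (+ 2 ℤ.+ + w)))
    ≡⟨ cong₂ ℤ._-_ (sym lhs) (sym rhs) ⟩
  + ((d + w) * (d + w) + w) ℤ.- + ((d + 1) * (w * (suc w * suc (suc w)))) ∎
  where
  open ≡-Reasoning
  s≡ : + suc (d + w + w) ≡ + 1 ℤ.+ (+ d ℤ.+ + w ℤ.+ + w)
  s≡ = trans (pos-+ 1 (d + w + w))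
         (cong (λ i → + 1 ℤ.+ i) (trans (pos-+ (d + w) w) (cong (λ i → i ℤ.+ + w) (pos-+ d w))))
  lhs : + ((d + w) * (d + w) + w) ≡ (+ d ℤ.+ + w) ℤ.* (+ d ℤ.+ + w) ℤ.+ + w
  lhs = trans (pos-+ _ w)
          (cong (λ i → i ℤ.+ + w) (trans (pos-* (d + w) (d + w)) (cong₂ ℤ._*_ (pos-+ d w) (pos-+ d w))))
  rhs : + ((d + 1) * (w * (suc w * suc (suc w)))) ≡
        (+ d ℤ.+ + 1) ℤ.* (+ w ℤ.* ((+ 1 ℤ.+ + w) ℤ.* (+ 2 ℤ.+ + w)))
  rhs = trans (pos-* (d + 1) _) (cong₂ ℤ._*_ (pos-+ d 1) (trans (pos-* w _) (cong (λ i → + w ℤ.* i)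
          (trans (pos-* (suc w) (suc (suc w))) (cong₂ ℤ._*_ (pos-+ 1 w) (pos-+ 2 w))))))

far-from-both-formula : ∀ D u K P →
  suc (D + u + u) * suc (suc u) ≡ suc u * suc (suc u) + K →
  (D + suc u) * suc (D + u + u) ≡ K + suc P →
  P ≡ (D + u) * (D + u) + u
far-from-both-formula D u K P e₁ e₂ = suc-injective (+-cancelʳ-≡ (s * suc t) _ _ (begin
  suc P + s * suc t                  ≡⟨ cong (λ n → suc P + n) e₁ ⟩
  suc P + (t * suc t + K)            ≡⟨ rearrange (suc P) (t * suc t) K ⟩
  K + suc P + t * suc t              ≡⟨ cong (λ n → n + t * suc t) e₂ ⟨
  (D + t) * s + t * suc t            ≡⟨ expand D u ⟩
  suc ((D + u) * (D + u) + u) + s * suc t ∎))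
  where
  open ≡-Reasoning
  open ℕ-Solver
  s t : ℕ
  s = suc (D + u + u)
  t = suc u
  rearrange : ∀ p m k → p + (m + k) ≡ k + p + m
  rearrange = solve 3 (λ p m k → p :+ (m :+ k) := (k :+ p) :+ m) refl
  expand : ∀ D u → (D + suc u) * suc (D + u + u) + suc u * suc (suc u) ≡
                   suc ((D + u) * (D + u) + u) + suc (D + u + u) * suc (suc u)
  expand = solve 2 (λ D u →
    (D :+ (con 1 :+ u)) :* (con 1 :+ D :+ u :+ u) :+ (con 1 :+ u) :* (con 2 :+ u)
    := con 1 :+ ((D :+ u) :* (D :+ u) :+ u) :+ (con 1 :+ D :+ u :+ u) :* (con 2 :+ u)) refl

s≡1+D+2u : ∀ {s u D} → D + (suc u + suc u) ≡ suc s → s ≡ suc (D + u + u)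
s≡1+D+2u {u = u} {D} D+2t≡s+1 = suc-injective (trans (sym D+2t≡s+1)
  (solve 2 (λ D u → D :+ ((con 1 :+ u) :+ (con 1 :+ u)) := con 2 :+ (D :+ u :+ u)) refl D u))
  where open ℕ-Solver

net-inequality : ∀ {s u D K P} → D + (suc u + suc u) ≡ suc s →
  s * suc (suc u) ≡ suc u * suc (suc u) + K → (D + suc u) * s ≡ K + suc P →
  P ≤ (D + 1) * (u * (suc u * suc (suc u))) →
  netPolynomial (+ s) (+ suc u) ℤ.≤ + 0
net-inequality {u = u} {D} {K} {P} D+2t≡s+1 e₁ e₂ P≤ with s≡1+D+2u D+2t≡s+1
... | refl = subst (ℤ._≤ + 0) (sym (netPolynomial≡ D u)) (i≤j⇒i-j≤0 (ℤ.+≤+ bound))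
  where
  bound : (D + u) * (D + u) + u ≤ (D + 1) * (u * (suc u * suc (suc u)))
  bound = subst (_≤ (D + 1) * (u * (suc u * suc (suc u)))) (far-from-both-formula D u K P e₁ e₂) P≤

module PartialGeometry {S : IncidenceStructure} {s t α : ℕ} (pg : IsPartialGeometry S s t α) where
  open IncidenceStructure S
  open IsPartialGeometry pg

  infix 4 _I_
  _I_ : Fin v → Fin b → Set
  p I L = T (inc p L)

  pointsOn? : ∀ L → Decidable (_I L)
  pointsOn? L q = T? (inc q L)

  linesThrough? : ∀ p → Decidable (p I_)
  linesThrough? p M = T? (inc p M)

  Meets : Fin b → Fin b → Set
  Meets L M = ∃ λ q → q I M × q I L

  meets? : ∀ L → Decidable (Meets L)
  meets? L M = any? (pointsOn? M ∩? pointsOn? L)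

  T-meets : ∀ {M L} → T (meets M L) ⇔ Meets L M
  T-meets = mk⇔ (map₂ (Equivalence.to T-∧) ∘ Equivalence.to T-anyFin)
                (Equivalence.from T-anyFin ∘ map₂ (Equivalence.from T-∧))

  adj? : ∀ p q → Dec (Adj p q)
  adj? p q = ¬? (p ≟ q) ×-dec any? (λ L → T? (inc p L) ×-dec T? (inc q L))

  Adj-sym : ∀ {p q} → Adj p q → Adj q p
  Adj-sym (p≢q , L , pL , qL) = p≢q ∘ sym , L , qL , pL

  Far : Fin v → Fin v → Set
  Far x y = x ≢ y × ¬ Adj x y

  far? : ∀ x y → Dec (Far x y)
  far? x y = ¬? (x ≟ y) ×-dec ¬? (adj? x y)

  unique-line : ∀ {p q L M} → p ≢ q → p I L → q I L → p I M → q I M → L ≡ M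
  unique-line p≢q = atMostOne _ _ p≢q _ _

  points-on : ∀ L → count (pointsOn? L) ≡ suc s
  points-on L = trans (sym (#Fin≡count (λ q → inc q L))) (linePoints L)

  lines-through : ∀ p → count (linesThrough? p) ≡ suc t
  lines-through p = trans (sym (#Fin≡count (inc p))) (pointLines p)

  lines-through-meeting : ∀ p L → ¬ p I L → count (linesThrough? p ∩? meets? L) ≡ α
  lines-through-meeting p L p∉L = begin
    count (linesThrough? p ∩? meets? L)
      ≡⟨ count-cong (linesThrough? p ∩? meets? L) (linesThrough? p ∩? (T? ∘ λ M → meets M L)) ⇔meets ⟩
    count (linesThrough? p ∩? (T? ∘ λ M → meets M L))
      ≡⟨ count-∧ (inc p) (λ M → meets M L) ⟨
    count (T? ∘ λ M → inc p M ∧ meets M L)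
      ≡⟨ #Fin≡count (λ M → inc p M ∧ meets M L) ⟨
    #Fin (λ M → inc p M ∧ meets M L)
      ≡⟨ alphaAx p L p∉L ⟩
    α ∎
    where
    open ≡-Reasoning
    ⇔meets : (λ M → p I M × Meets L M) ≐ (λ M → p I M × T (meets M L))
    ⇔meets = map₂ (Equivalence.from T-meets) , map₂ (Equivalence.to T-meets)

  -- Every neighbour of p lies on exactly one line through p.
  count-Adj-by-lines : ∀ p {Q : Pred (Fin v) _} (Q? : Decidable Q)
    {H : Pred (Fin b) _} (H? : Decidable H) {c} → ¬ Q p →
    (∀ M → p I M → H M → count (pointsOn? M ∩? Q?) ≡ c) →
    (∀ M → p I M → ¬ H M → count (pointsOn? M ∩? Q?) ≡ 0) →
    count (adj? p ∩? Q?) ≡ c * count (linesThrough? p ∩? H?)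
  count-Adj-by-lines p {Q} Q? {H} H? {c} ¬Qp onH offH = begin
    count (adj? p ∩? Q?)                ≡⟨ *-identityˡ _ ⟨
    1 * count (adj? p ∩? Q?)            ≡⟨ ∑-constant-on (adj? p ∩? Q?) (count ∘ lines-via) one-line no-line ⟨
    ∑[ q < v ] count (lines-via q)      ≡⟨ ∑-count-comm via? ⟨
    ∑[ M < b ] count (via? M)           ≡⟨ ∑-constant-on (linesThrough? p ∩? H?) (count ∘ via?) on off ⟩
    c * count (linesThrough? p ∩? H?)   ∎
    where
    open ≡-Reasoning
    Via : Fin b → Fin v → Set
    Via M q = p I M × q I M × Q q
    via? : ∀ M q → Dec (Via M q)
    via? M q = linesThrough? p M ×-dec (pointsOn? M ∩? Q?) q
    lines-via : ∀ q → Decidable (λ M → Via M q)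
    lines-via q M = via? M q

    one-line : ∀ q → Adj p q × Q q → count (lines-via q) ≡ 1
    one-line q ((p≢q , L , pL , qL) , Qq) =
      count-unique (lines-via q) (pL , qL , Qq) λ (pM , qM , _) → unique-line p≢q pM qM pL qL
    no-line : ∀ q → ¬ (Adj p q × Q q) → count (lines-via q) ≡ 0
    no-line q ¬adj = count-none (lines-via q)
      λ M (pM , qM , Qq) → ¬adj (((λ { refl → ¬Qp Qq }) , M , pM , qM) , Qq)

    restrict : ∀ {M} → p I M → count (via? M) ≡ count (pointsOn? M ∩? Q?)
    restrict {M} pM = count-cong (via? M) (pointsOn? M ∩? Q?) (proj₂ , (pM ,_))
    on : ∀ M → p I M × H M → count (via? M) ≡ c
    on M (pM , HM) = trans (restrict pM) (onH M pM HM)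
    off : ∀ M → ¬ (p I M × H M) → count (via? M) ≡ 0
    off M ¬pH with linesThrough? p M
    ... | yes pM = trans (restrict pM) (offH M pM (λ HM → ¬pH (pM , HM)))
    ... | no p∉M = count-none (via? M) (λ q → p∉M ∘ proj₁)

  count-Adj-on-line : ∀ {p L} → ¬ p I L → count (pointsOn? L ∩? adj? p) ≡ α
  count-Adj-on-line {p} {L} p∉L = begin
    count (pointsOn? L ∩? adj? p)            ≡⟨ count-∩-comm (pointsOn? L) (adj? p) ⟩
    count (adj? p ∩? pointsOn? L)            ≡⟨ count-Adj-by-lines p (pointsOn? L) (meets? L) p∉L
                                                  one-point no-point ⟩
    1 * count (linesThrough? p ∩? meets? L)  ≡⟨ *-identityˡ _ ⟩
    count (linesThrough? p ∩? meets? L)      ≡⟨ lines-through-meeting p L p∉L ⟩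
    α                                        ∎
    where
    open ≡-Reasoning
    one-point : ∀ M → p I M → Meets L M → count (pointsOn? M ∩? pointsOn? L) ≡ 1
    one-point M pM (q , qM , qL) = count-unique (pointsOn? M ∩? pointsOn? L) (qM , qL) same-point
      where
      same-point : ∀ {q′} → q′ I M × q′ I L → q′ ≡ q
      same-point {q′} (q′M , q′L) with q′ ≟ q
      ... | yes q′≡q = q′≡q
      ... | no q′≢q  = ⊥-elim (p∉L (subst (p I_) (unique-line q′≢q q′M qM q′L qL) pM))
    no-point : ∀ M → p I M → ¬ Meets L M → count (pointsOn? M ∩? pointsOn? L) ≡ 0
    no-point M _ ¬meet =
      count-none (pointsOn? M ∩? pointsOn? L) (λ q (qM , qL) → ¬meet (q , qM , qL))

  others-on-line : ∀ {p M} → p I M → count (pointsOn? M ∩? ∁? (p ≟_)) ≡ s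
  others-on-line {p} {M} pM = suc-injective (begin
    suc (count (pointsOn? M ∩? ∁? (p ≟_)))
      ≡⟨ cong (_+ count (pointsOn? M ∩? ∁? (p ≟_))) only-p ⟨
    count (pointsOn? M ∩? (p ≟_)) + count (pointsOn? M ∩? ∁? (p ≟_))
      ≡⟨ count-split (pointsOn? M) (p ≟_) ⟨
    count (pointsOn? M)
      ≡⟨ points-on M ⟩
    suc s ∎)
    where
    open ≡-Reasoning
    only-p : count (pointsOn? M ∩? (p ≟_)) ≡ 1
    only-p = count-unique (pointsOn? M ∩? (p ≟_)) (pM , refl) (sym ∘ proj₂)

  degree : ∀ p → count (adj? p) ≡ s * suc t
  degree p = begin
    count (adj? p)                      ≡⟨ count-cong (adj? p) (adj? p ∩? ∁? (p ≟_)) (< id , proj₁ > , proj₁) ⟩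
    count (adj? p ∩? ∁? (p ≟_))         ≡⟨ count-Adj-by-lines p (∁? (p ≟_)) U? (λ p≢p → p≢p refl)
                                             (λ M pM _ → others-on-line pM) (λ _ _ ¬U → ⊥-elim (¬U _)) ⟩
    s * count (linesThrough? p ∩? U?)   ≡⟨ cong (s *_) (trans (count-∩-U (linesThrough? p)) (lines-through p)) ⟩
    s * suc t                           ∎
    where open ≡-Reasoning

  common-neighbours : ∀ {x y} → Far x y → count (adj? x ∩? adj? y) ≡ α * suc t
  common-neighbours {x} {y} (x≢y , ¬x~y) = begin
    count (adj? x ∩? adj? y)             ≡⟨ count-Adj-by-lines x (adj? y) U? (¬x~y ∘ Adj-sym)
                                              (λ M xM _ → count-Adj-on-line (λ yM → ¬x~y (x≢y , M , xM , yM)))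
                                              (λ _ _ ¬U → ⊥-elim (¬U _)) ⟩
    α * count (linesThrough? x ∩? U?)    ≡⟨ cong (α *_) (trans (count-∩-U (linesThrough? x))
                                                                  (lines-through x)) ⟩
    α * suc t                            ∎
    where open ≡-Reasoning

  lines-through-avoiding : ∀ {z x} → Adj z x → count (linesThrough? z ∩? ∁? (linesThrough? x)) ≡ t
  lines-through-avoiding {z} {x} (z≢x , L , zL , xL) = suc-injective (begin
    suc (count (linesThrough? z ∩? ∁? (linesThrough? x)))
      ≡⟨ cong (_+ count (linesThrough? z ∩? ∁? (linesThrough? x))) only-L ⟨
    count (linesThrough? z ∩? linesThrough? x) + count (linesThrough? z ∩? ∁? (linesThrough? x))
      ≡⟨ count-split (linesThrough? z) (linesThrough? x) ⟨
    count (linesThrough? z)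
      ≡⟨ lines-through z ⟩
    suc t ∎)
    where
    open ≡-Reasoning
    only-L : count (linesThrough? z ∩? linesThrough? x) ≡ 1
    only-L = count-unique (linesThrough? z ∩? linesThrough? x) (zL , xL)
               (λ (zM , xM) → unique-line z≢x zM xM zL xL)

  count-non-Adj-on-line : ∀ {x L} → ¬ x I L → count (pointsOn? L ∩? ∁? (adj? x)) + α ≡ suc s
  count-non-Adj-on-line {x} {L} x∉L = begin
    count (pointsOn? L ∩? ∁? (adj? x)) + α
      ≡⟨ +-comm _ α ⟩
    α + count (pointsOn? L ∩? ∁? (adj? x))
      ≡⟨ cong (_+ count (pointsOn? L ∩? ∁? (adj? x))) (count-Adj-on-line x∉L) ⟨
    count (pointsOn? L ∩? adj? x) + count (pointsOn? L ∩? ∁? (adj? x))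
      ≡⟨ count-split (pointsOn? L) (adj? x) ⟨
    count (pointsOn? L)
      ≡⟨ points-on L ⟩
    suc s ∎
    where open ≡-Reasoning

  count-Far-neighbours : ∀ {x z a} → a + α ≡ suc s → Adj x z → count (adj? z ∩? far? x) ≡ a * t
  count-Far-neighbours {x} {z} {a} a+α≡s+1 x~z = begin
    count (adj? z ∩? far? x)
      ≡⟨ count-Adj-by-lines z (far? x) (∁? (linesThrough? x)) (λ (_ , ¬x~z) → ¬x~z x~z) avoiding through ⟩
    a * count (linesThrough? z ∩? ∁? (linesThrough? x))
      ≡⟨ cong (a *_) (lines-through-avoiding (Adj-sym x~z)) ⟩
    a * t ∎
    where
    open ≡-Reasoning
    avoiding : ∀ M → z I M → ¬ x I M → count (pointsOn? M ∩? far? x) ≡ a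
    avoiding M _ x∉M = +-cancelʳ-≡ _ _ _ (begin
      count (pointsOn? M ∩? far? x) + α
        ≡⟨ cong (_+ α) (count-cong (pointsOn? M ∩? far? x) (pointsOn? M ∩? ∁? (adj? x))
                           (map₂ proj₂ , λ (qM , ¬x~q) → qM , (λ { refl → x∉M qM }) , ¬x~q)) ⟩
      count (pointsOn? M ∩? ∁? (adj? x)) + α
        ≡⟨ count-non-Adj-on-line x∉M ⟩
      suc s
        ≡⟨ a+α≡s+1 ⟨
      a + α ∎)
    through : ∀ M → z I M → ¬ ¬ x I M → count (pointsOn? M ∩? far? x) ≡ 0
    through M _ ¬x∉M = count-none (pointsOn? M ∩? far? x)
      λ q (qM , x≢q , ¬x~q) → ¬x∉M λ xM → ¬x~q (x≢q , M , xM , qM)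

  non-neighbours-double-count : ∀ {x a} → a + α ≡ suc s →
    count (far? x) * (α * suc t) ≡ (a * t) * (s * suc t)
  non-neighbours-double-count {x} {a} a+α≡s+1 = begin
    count (far? x) * (α * suc t)      ≡⟨ *-comm (count (far? x)) _ ⟩
    (α * suc t) * count (far? x)      ≡⟨ ∑-constant-on (far? x) (count ∘ middles) middle-points no-path ⟨
    ∑[ y < v ] count (middles y)      ≡⟨ ∑-count-comm path? ⟨
    ∑[ z < v ] count (path? z)        ≡⟨ ∑-constant-on (adj? x) (count ∘ path?) end-points not-adjacent ⟩
    (a * t) * count (adj? x)          ≡⟨ cong ((a * t) *_) (degree x) ⟩
    (a * t) * (s * suc t)             ∎
    where
    open ≡-Reasoning
    Path : Fin v → Fin v → Set
    Path z y = Adj x z × Adj z y × Far x y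
    path? : ∀ z y → Dec (Path z y)
    path? z y = adj? x z ×-dec adj? z y ×-dec far? x y
    middles : ∀ y → Decidable (λ z → Path z y)
    middles y z = path? z y

    middle-points : ∀ y → Far x y → count (middles y) ≡ α * suc t
    middle-points y far = trans (count-cong (middles y) (adj? x ∩? adj? y) (to , from)) (common-neighbours far)
      where
      to : ∀ {z} → Path z y → Adj x z × Adj y z
      to (x~z , z~y , _) = x~z , Adj-sym z~y
      from : ∀ {z} → Adj x z × Adj y z → Path z y
      from (x~z , y~z) = x~z , Adj-sym y~z , far
    no-path : ∀ y → ¬ Far x y → count (middles y) ≡ 0
    no-path y ¬far = count-none (middles y) (λ z → ¬far ∘ proj₂ ∘ proj₂)
    end-points : ∀ z → Adj x z → count (path? z) ≡ a * t
    end-points z x~z = trans (count-cong (path? z) (adj? z ∩? far? x) (proj₂ , (x~z ,_)))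
                             (count-Far-neighbours a+α≡s+1 x~z)
    not-adjacent : ∀ z → ¬ Adj x z → count (path? z) ≡ 0
    not-adjacent z ¬x~z = count-none (path? z) (λ y → ¬x~z ∘ proj₁)

  degree-split : ∀ {x y} → Far x y → count (adj? y) ≡ α * suc t + count (far? x ∩? adj? y)
  degree-split {x} {y} far@(_ , ¬x~y) = begin
    count (adj? y)                                            ≡⟨ count-split (adj? y) (adj? x) ⟩
    count (adj? y ∩? adj? x) + count (adj? y ∩? ∁? (adj? x))  ≡⟨ cong₂ _+_ common rest ⟩
    α * suc t + count (far? x ∩? adj? y)                      ∎
    where
    open ≡-Reasoning
    common : count (adj? y ∩? adj? x) ≡ α * suc t
    common = trans (count-∩-comm (adj? y) (adj? x)) (common-neighbours far)
    x≢z : ∀ {z} → Adj y z → x ≢ z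
    x≢z y~x refl = ¬x~y (Adj-sym y~x)
    rest : count (adj? y ∩? ∁? (adj? x)) ≡ count (far? x ∩? adj? y)
    rest = count-cong (adj? y ∩? ∁? (adj? x)) (far? x ∩? adj? y)
             ((λ (y~z , ¬x~z) → (x≢z y~z , ¬x~z) , y~z) , (λ ((_ , ¬x~z) , y~z) → y~z , ¬x~z))

  non-neighbours-split : ∀ {x y} → Far x y →
    count (far? x) ≡ count (far? x ∩? adj? y) + suc (count (far? x ∩? far? y))
  non-neighbours-split {x} {y} far = begin
    count (far? x)
      ≡⟨ count-split (far? x) (adj? y) ⟩
    count (far? x ∩? adj? y) + count X∖Y?
      ≡⟨ cong (_+_ (count (far? x ∩? adj? y))) (count-split X∖Y? (_≟ y)) ⟩
    count (far? x ∩? adj? y) + (count (X∖Y? ∩? (_≟ y)) + count (X∖Y? ∩? ∁? (_≟ y)))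
      ≡⟨ cong (_+_ (count (far? x ∩? adj? y))) (cong₂ _+_ just-y rest) ⟩
    count (far? x ∩? adj? y) + suc (count (far? x ∩? far? y)) ∎
    where
    open ≡-Reasoning
    X∖Y? : Decidable (λ z → Far x z × ¬ Adj y z)
    X∖Y? = far? x ∩? ∁? (adj? y)
    just-y : count (X∖Y? ∩? (_≟ y)) ≡ 1
    just-y = count-unique (X∖Y? ∩? (_≟ y)) ((far , λ (y≢y , _) → y≢y refl) , refl) proj₂
    rest : count (X∖Y? ∩? ∁? (_≟ y)) ≡ count (far? x ∩? far? y)
    rest = count-cong (X∖Y? ∩? ∁? (_≟ y)) (far? x ∩? far? y)
             ( (λ ((far-x , ¬y~z) , z≢y) → far-x , z≢y ∘ sym , ¬y~z)
             , (λ (far-x , y≢z , ¬y~z) → (far-x , ¬y~z) , y≢z ∘ sym))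

  module FarPair {x y} (x-far-y : Far x y) where

    Avoids : Fin b → Set
    Avoids ℓ = ¬ x I ℓ × ¬ y I ℓ

    avoids? : Decidable Avoids
    avoids? ℓ = ¬? (linesThrough? x ℓ) ×-dec ¬? (linesThrough? y ℓ)

    common? : Decidable (λ c → Adj x c × Adj y c)
    common? = adj? x ∩? adj? y

    Good : Fin b → Set
    Good ℓ = Avoids ℓ × ∃ λ c → c I ℓ × Adj x c × Adj y c

    good? : Decidable Good
    good? ℓ = avoids? ℓ ×-dec any? (pointsOn? ℓ ∩? common?)

    far-on-avoiding-line : ∀ {ℓ} → Avoids ℓ →
      count (pointsOn? ℓ ∩? (far? x ∩? far? y)) + (α + α) ≤ suc s + count (pointsOn? ℓ ∩? common?)
    far-on-avoiding-line {ℓ} (x∉ℓ , y∉ℓ) = begin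
      F + (α + α)
        ≡⟨ cong (_+_ F) two-α ⟨
      F + (count (X? ∪? Y?) + C)
        ≡⟨ +-assoc F _ C ⟨
      F + count (X? ∪? Y?) + C
        ≤⟨ +-monoˡ-≤ C (≤-trans F+X∪Y≤ℓ (≤-reflexive (points-on ℓ))) ⟩
      suc s + C ∎
      where
      open ≤-Reasoning
      X? : Decidable (λ z → z I ℓ × Adj x z)
      X? = pointsOn? ℓ ∩? adj? x
      Y? : Decidable (λ z → z I ℓ × Adj y z)
      Y? = pointsOn? ℓ ∩? adj? y
      F C : ℕ
      F = count (pointsOn? ℓ ∩? (far? x ∩? far? y))
      C = count (pointsOn? ℓ ∩? common?)
      X∩Y≡C : count (X? ∩? Y?) ≡ C
      X∩Y≡C = count-cong (X? ∩? Y?) (pointsOn? ℓ ∩? common?)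
                ( (λ ((zℓ , x~z) , (_ , y~z)) → zℓ , x~z , y~z)
                , (λ (zℓ , x~z , y~z) → (zℓ , x~z) , (zℓ , y~z)))
      two-α : count (X? ∪? Y?) + C ≡ α + α
      two-α = begin-equality
        count (X? ∪? Y?) + C                 ≡⟨ cong (_+_ (count (X? ∪? Y?))) X∩Y≡C ⟨
        count (X? ∪? Y?) + count (X? ∩? Y?)  ≡⟨ count-∪+∩ X? Y? ⟩
        count X? + count Y?                  ≡⟨ cong₂ _+_ (count-Adj-on-line x∉ℓ) (count-Adj-on-line y∉ℓ) ⟩
        α + α                                ∎
      disjoint : ∀ z → z I ℓ × Far x z × Far y z → (z I ℓ × Adj x z) ⊎ (z I ℓ × Adj y z) → ⊥
      disjoint z (_ , (_ , ¬x~z) , _) (inj₁ (_ , x~z)) = ¬x~z x~z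
      disjoint z (_ , _ , (_ , ¬y~z)) (inj₂ (_ , y~z)) = ¬y~z y~z
      on-ℓ : ∀ {z} → (z I ℓ × Adj x z) ⊎ (z I ℓ × Adj y z) → z I ℓ
      on-ℓ (inj₁ (zℓ , _)) = zℓ
      on-ℓ (inj₂ (zℓ , _)) = zℓ
      F+X∪Y≤ℓ : F + count (X? ∪? Y?) ≤ count (pointsOn? ℓ)
      F+X∪Y≤ℓ = count-disjoint-+≤ (pointsOn? ℓ ∩? (far? x ∩? far? y)) (X? ∪? Y?) (pointsOn? ℓ)
                  disjoint proj₁ on-ℓ

    Witness : Fin b → Fin v → Set
    Witness ℓ c = Avoids ℓ × c I ℓ × Adj x c × Adj y c

    witness? : ∀ ℓ c → Dec (Witness ℓ c)
    witness? ℓ c = avoids? ℓ ×-dec (pointsOn? ℓ ∩? common?) c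

    Covered : Fin b → Fin v → Set
    Covered ℓ z = Good ℓ × z I ℓ × Far x z × Far y z

    covered? : ∀ ℓ z → Dec (Covered ℓ z)
    covered? ℓ z = good? ℓ ×-dec (pointsOn? ℓ ∩? (far? x ∩? far? y)) z

    covered-on-line : ∀ {D} → D + (α + α) ≡ suc s → ∀ ℓ →
      count (covered? ℓ) ≤ (D + 1) * count (witness? ℓ)
    covered-on-line {D} D+2α≡s+1 ℓ with good? ℓ
    ... | no ¬good = ≤-trans (≤-reflexive (count-none (covered? ℓ) (λ z → ¬good ∘ proj₁))) z≤n
    ... | yes good@(avoids , c , cℓ , x~c , y~c) = begin
      count (covered? ℓ)            ≡⟨ count-cong (covered? ℓ) F? (proj₂ , (good ,_)) ⟩
      count F?                      ≤⟨ +-cancelʳ-≤ (α + α) (count F?) (D + C) F+2α≤D+C+2α ⟩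
      D + C                         ≤⟨ m+n≤[m+1]*n D C (∃⇒count>0 (pointsOn? ℓ ∩? common?) (cℓ , x~c , y~c)) ⟩
      (D + 1) * C                   ≡⟨ cong ((D + 1) *_) witnesses ⟨
      (D + 1) * count (witness? ℓ)  ∎
      where
      open ≤-Reasoning
      F? : Decidable (λ z → z I ℓ × Far x z × Far y z)
      F? = pointsOn? ℓ ∩? (far? x ∩? far? y)
      C : ℕ
      C = count (pointsOn? ℓ ∩? common?)
      F+2α≤D+C+2α : count F? + (α + α) ≤ D + C + (α + α)
      F+2α≤D+C+2α = ≤-trans (far-on-avoiding-line avoids)
                      (≤-reflexive (trans (cong (_+ C) (sym D+2α≡s+1)) (xy∙z≈xz∙y D (α + α) C)))
      witnesses : count (witness? ℓ) ≡ C
      witnesses = count-cong (witness? ℓ) (pointsOn? ℓ ∩? common?) (proj₂ , (avoids ,_))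

    lines-through-common-avoiding : ∀ {c} → Adj x c → Adj y c → suc (count (λ ℓ → witness? ℓ c)) ≡ t
    lines-through-common-avoiding {c} x~c y~c@(y≢c , L , yL , cL) = begin
      suc (count (λ ℓ → witness? ℓ c))
        ≡⟨ cong₂ _+_ only-L (sym fibre) ⟨
      count (C∖X? ∩? linesThrough? y) + count (C∖X? ∩? ∁? (linesThrough? y))
        ≡⟨ count-split C∖X? (linesThrough? y) ⟨
      count C∖X?
        ≡⟨ lines-through-avoiding (Adj-sym x~c) ⟩
      t ∎
      where
      open ≡-Reasoning
      C∖X? : Decidable (λ ℓ → c I ℓ × ¬ x I ℓ)
      C∖X? = linesThrough? c ∩? ∁? (linesThrough? x)
      x∉L : ¬ x I L
      x∉L xL = proj₂ x-far-y (proj₁ x-far-y , L , xL , yL)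
      only-L : count (C∖X? ∩? linesThrough? y) ≡ 1
      only-L = count-unique (C∖X? ∩? linesThrough? y) ((cL , x∉L) , yL)
                 λ ((cM , _) , yM) → unique-line y≢c yM cM yL cL
      fibre : count (λ ℓ → witness? ℓ c) ≡ count (C∖X? ∩? ∁? (linesThrough? y))
      fibre = count-cong (λ ℓ → witness? ℓ c) (C∖X? ∩? ∁? (linesThrough? y))
                ( (λ ((x∉ℓ , y∉ℓ) , cℓ , _) → (cℓ , x∉ℓ) , y∉ℓ)
                , (λ ((cℓ , x∉ℓ) , y∉ℓ) → (x∉ℓ , y∉ℓ) , cℓ , x~c , y~c))

    ∑-witnesses : ∑[ ℓ < b ] count (witness? ℓ) ≡ (t ∸ 1) * (α * suc t)
    ∑-witnesses = begin
      ∑[ ℓ < b ] count (witness? ℓ)  ≡⟨ ∑-count-comm witness? ⟩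
      ∑[ c < v ] count (lines c)     ≡⟨ ∑-constant-on common? (count ∘ lines) on off ⟩
      (t ∸ 1) * count common?        ≡⟨ cong ((t ∸ 1) *_) (common-neighbours x-far-y) ⟩
      (t ∸ 1) * (α * suc t)          ∎
      where
      open ≡-Reasoning
      lines : ∀ c → Decidable (λ ℓ → Witness ℓ c)
      lines c ℓ = witness? ℓ c
      on : ∀ c → Adj x c × Adj y c → count (lines c) ≡ t ∸ 1
      on c (x~c , y~c) = cong (_∸ 1) (lines-through-common-avoiding x~c y~c)
      off : ∀ c → ¬ (Adj x c × Adj y c) → count (lines c) ≡ 0
      off c ¬common = count-none (lines c) (λ ℓ → ¬common ∘ proj₂ ∘ proj₂)

    good-line-through : ∀ {z w} → Far x z → Far y z → Adj w x → Adj w y → Adj w z →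
      ∃ λ ℓ → Good ℓ × z I ℓ
    good-line-through {w = w} (x≢z , ¬x~z) (y≢z , ¬y~z) w~x w~y (_ , ℓ , wℓ , zℓ) =
      ℓ , (avoids , w , wℓ , Adj-sym w~x , Adj-sym w~y) , zℓ
      where
      avoids : Avoids ℓ
      avoids = (λ xℓ → ¬x~z (x≢z , ℓ , xℓ , zℓ)) , (λ yℓ → ¬y~z (y≢z , ℓ , yℓ , zℓ))

    count-far-from-both≤ : ∀ {D} → D + (α + α) ≡ suc s →
      (∀ {z} → Far x z → Far y z → ∃ λ ℓ → Good ℓ × z I ℓ) →
      count (far? x ∩? far? y) ≤ (D + 1) * ((t ∸ 1) * (α * suc t))
    count-far-from-both≤ {D} D+2α≡s+1 covering = begin
      count (far? x ∩? far? y)                   ≤⟨ count≤∑-cover (far? x ∩? far? y) covered? cover ⟩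
      ∑[ ℓ < b ] count (covered? ℓ)              ≤⟨ ∑-mono-≤ (covered-on-line {D} D+2α≡s+1) ⟩
      ∑[ ℓ < b ] ((D + 1) * count (witness? ℓ))  ≡⟨ *-distribˡ-sum (D + 1) (count ∘ witness?) ⟨
      (D + 1) * ∑[ ℓ < b ] count (witness? ℓ)    ≡⟨ cong ((D + 1) *_) ∑-witnesses ⟩
      (D + 1) * ((t ∸ 1) * (α * suc t))          ∎
      where
      open ≤-Reasoning
      cover : ∀ {z} → Far x z × Far y z → ∃ λ ℓ → Covered ℓ z
      cover (x-far-z , y-far-z) =
        let ℓ , good , zℓ = covering x-far-z y-far-z in ℓ , good , zℓ , x-far-z , y-far-z

non-neighbours-in-net : ∀ {S s t} (pg : IsPartialGeometry S s t t) .{{_ : NonZero t}} x {a} →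
  a + t ≡ suc s → count (PartialGeometry.far? pg x) ≡ a * s
non-neighbours-in-net {s = s} {t} pg x {a} a+t≡s+1 =
  *-cancelʳ-≡ _ (a * s) (t * suc t) {{m*n≢0 t (suc t)}}
    (trans (non-neighbours-double-count {x} a+t≡s+1) (regroup a t s))
  where
  open PartialGeometry pg
  open ℕ-Solver
  regroup : ∀ a t s → a * t * (s * suc t) ≡ a * s * (t * suc t)
  regroup = solve 3 (λ a t s → a :* t :* (s :* (con 1 :+ t)) := a :* s :* (t :* (con 1 :+ t))) refl

mainTheorem10 : (S : IncidenceStructure) (s t : ℕ) →
    IsPartialGeometry S s t t → Nondegenerate s t t →
    s + 1 ≥ 2 * t →
    IsNEC 3 (IncidenceStructure.Adj S) →
    (+ s) ^ 2 ℤ.- ((+ t) ^ 3 ℤ.+ (+ t)) ℤ.* (+ s) ℤ.+ (+ 2) ℤ.* (+ t) ^ 4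
      ℤ.- (+ 2) ℤ.* (+ t) ^ 3 ℤ.- (+ t) ^ 2 ℤ.+ (+ 3) ℤ.* (+ t) ℤ.- (+ 1) ℤ.≤ (+ 0)
mainTheorem10 S s zero    pg (_ , () , _) _ _
mainTheorem10 S s t@(suc u) pg (s≥2 , _) 2t≤s+1 nec =
  net-inequality D+2t≡s+1 (trans (sym (degree y)) (degree-split x-far-y))
                 (trans (sym (non-neighbours-in-net pg x D+t+t≡s+1)) (non-neighbours-split x-far-y))
                 (count-far-from-both≤ D+2t≡s+1 covering)
  where
  open IncidenceStructure S
  open IsPartialGeometry pg using (nonempty)
  open PartialGeometry pg
  D : ℕ
  D = suc s ∸ (t + t)
  D+2t≡s+1 : D + (t + t) ≡ suc s
  D+2t≡s+1 = m∸n+n≡m (subst₂ _≤_ (cong (λ n → t + n) (+-identityʳ t)) (+-comm s 1) 2t≤s+1)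
  D+t+t≡s+1 : D + t + t ≡ suc s
  D+t+t≡s+1 = trans (+-assoc D t t) D+2t≡s+1
  x : Fin v
  x = nonempty
  far-from-x : ∃ (Far x)
  far-from-x = count>0⇒∃ (far? x) (subst (0 <_) (sym (non-neighbours-in-net pg x D+t+t≡s+1))
                 (*-mono-≤ (≤-trans (s≤s z≤n) (m≤n+m t D)) (≤-trans (s≤s z≤n) s≥2)))
  y : Fin v
  y = proj₁ far-from-x
  x-far-y : Far x y
  x-far-y = proj₂ far-from-x
  open FarPair x-far-y
  covering : ∀ {z} → Far x z → Far y z → ∃ λ ℓ → Good ℓ × z I ℓ
  covering x-far-z@(x≢z , _) y-far-z@(y≢z , _) =
    let w , w~x , w~y , w~z = IsNEC-3⇒common-neighbour nec (proj₁ x-far-y) x≢z y≢z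
    in good-line-through x-far-z y-far-z w~x w~y w~z
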